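{- Define $a(1)=1$ and, for $n>1$, $a(n)=1+\sum_m a(m)$ over all proper divisors $m$ of $n$ (positive divisors $m<n$). For positive integers $n,k$ define $a(n,k)$ by: $a(n,n)=1$; if $k$ is a proper divisor of $n$, $a(n,k)=\sum_m a(m,k)$ over all proper divisors $m$ of $n$; and $a(n,k)=0$ otherwise. Then for every integer $n>1$, $$a(n,1)=\tfrac{1}{2}\,a(n).$$
   Context: $a(n)$ is the number of recursive divisors of $n$, and $a(n,k)$ is the number of recursive divisors of $n$ equal to $k$ (the multiplicity of $k$ in the multiset $R(n)=\{n\}\uplus\biguplus_{m\text{ proper divisor of }n}R(m)$, $R(1)=\{1\}$); in particular $a(n)=\sum_{k\mid n}a(n,k)$. -}

module Defs where

open import Data.Nat using (ℕ; zero; suc; _+_; _<?_)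
open import Data.Nat.Divisibility using (_∣?_)
open import Data.List using (List; []; _∷_; map; filter; downFrom)
open import Data.Nat.ListAction using (sum)
open import Relation.Nullary using (yes; no)
open import Relation.Nullary.Decidable using (does)
open import Data.Bool using (if_then_else_; _∧_)
open import Data.Nat using (_≟_)

properDivisors : ℕ → List ℕ
properDivisors n = filter (λ m → m ∣? n) (map suc (downFrom (pred′ n)))
  where
  pred′ : ℕ → ℕ
  pred′ zero = zero
  pred′ (suc k) = k

-- Fuel-based recursion: aF f n computes a(n) whenever f ≥ n
-- (proper divisors of n are < n, so fuel n suffices).
aF : ℕ → ℕ → ℕ
aF zero    n = 1
aF (suc f) n = 1 + sum (map (aF f) (properDivisors n))

a : ℕ → ℕ
a n = aF n n

-- akF f n k computes a(n,k) whenever f ≥ n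
akF : ℕ → ℕ → ℕ → ℕ
akF zero    n k = 1
akF (suc f) n k =
  if does (k ≟ n) then 1
  else if does (k <? n) ∧ does (k ∣? n) ∧ does (0 <? k)
       then sum (map (λ m → akF f m k) (properDivisors n))
       else 0

a₂ : ℕ → ℕ → ℕ
a₂ n k = akF n n k

{-# OPTIONS --safe #-}
module Submission where

-- The proper divisors of n > 1 are 1 together with divisors m > 1, and by induction
-- 2·a(m,1) = a(m) for the latter. Since a(1,1) = a(1) = 1, doubling
-- a(n,1) = Σ_m a(m,1) gives Σ_{m>1} a(m) + 2 = 1 + (a(1) + Σ_{m>1} a(m)) = a(n).

open import Defs
open import Data.Product using (_×_; _,_)
open import Data.Nat using (ℕ; zero; suc; _+_; _*_; _<_; _≤_; s≤s; z≤n; _≟_)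
open import Data.Nat.Properties
  using (*-zeroʳ; *-distribˡ-+; +-identityʳ; ≤-refl; ≤-trans; +-commutativeSemigroup)
open import Algebra.Properties.CommutativeSemigroup +-commutativeSemigroup using (x∙yz≈y∙xz)
open import Data.Nat.Divisibility using (_∣_; _∣?_; 1∣_)
open import Data.Nat.ListAction using (sum)
open import Data.Nat.ListAction.Properties using (sum-++)
open import Data.List using (List; []; _∷_; _++_; _∷ʳ_; map; filter; downFrom; applyDownFrom)
open import Data.List.Properties
  using (map-++; map-downFrom; applyDownFrom-∷ʳ; filter-++; filter-accept)
open import Data.List.Relation.Unary.All as All using (All; []; _∷_)
open import Data.List.Relation.Unary.All.Properties using (applyDownFrom⁺₁; filter⁺)
open import Relation.Nullary.Decidable using (dec-true)
open import Relation.Unary using (Decidable)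
open import Relation.Binary.PropositionalEquality

sum-map-∷ʳ : ∀ {A : Set} (f : A → ℕ) xs x → sum (map f (xs ∷ʳ x)) ≡ sum (map f xs) + f x
sum-map-∷ʳ f xs x = begin
  sum (map f (xs ∷ʳ x))                 ≡⟨ cong sum (map-++ f xs (x ∷ [])) ⟩
  sum (map f xs ++ map f (x ∷ []))      ≡⟨ sum-++ (map f xs) (f x ∷ []) ⟩
  sum (map f xs) + (f x + 0)            ≡⟨ cong (sum (map f xs) +_) (+-identityʳ (f x)) ⟩
  sum (map f xs) + f x                  ∎
  where open ≡-Reasoning

*-sum-map : ∀ {A : Set} {f h : A → ℕ} {xs} d →
            All (λ x → d * f x ≡ h x) xs → d * sum (map f xs) ≡ sum (map h xs)
*-sum-map d []       = *-zeroʳ d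
*-sum-map d (p ∷ ps) = trans (*-distribˡ-+ d _ _) (cong₂ _+_ p (*-sum-map d ps))

*-sum-map-∷ʳ : ∀ {A : Set} {f h : A → ℕ} {xs x} d c →
               All (λ y → d * f y ≡ h y) xs → d * f x ≡ c + h x →
               d * sum (map f (xs ∷ʳ x)) ≡ c + sum (map h (xs ∷ʳ x))
*-sum-map-∷ʳ {f = f} {h} {xs} {x} d c ps p = begin
  d * sum (map f (xs ∷ʳ x))             ≡⟨ cong (d *_) (sum-map-∷ʳ f xs x) ⟩
  d * (sum (map f xs) + f x)            ≡⟨ *-distribˡ-+ d _ _ ⟩
  d * sum (map f xs) + d * f x          ≡⟨ cong₂ _+_ (*-sum-map d ps) p ⟩
  sum (map h xs) + (c + h x)            ≡⟨ x∙yz≈y∙xz (sum (map h xs)) c (h x) ⟩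
  c + (sum (map h xs) + h x)            ≡⟨ cong (c +_) (sum-map-∷ʳ h xs x) ⟨
  c + sum (map h (xs ∷ʳ x))             ∎
  where open ≡-Reasoning

nontrivialProperDivisors : ℕ → List ℕ
nontrivialProperDivisors k = filter (_∣? 2 + k) (applyDownFrom (2 +_) k)

properDivisors-∷ʳ : ∀ k → properDivisors (2 + k) ≡ nontrivialProperDivisors k ∷ʳ 1
properDivisors-∷ʳ k = begin
  filter P? (map suc (downFrom (suc k)))             ≡⟨ cong (filter P?) (map-downFrom suc (suc k)) ⟩
  filter P? (applyDownFrom suc (suc k))              ≡⟨ cong (filter P?) (applyDownFrom-∷ʳ suc k) ⟨
  filter P? (applyDownFrom (2 +_) k ∷ʳ 1)            ≡⟨ filter-++ P? (applyDownFrom (2 +_) k) (1 ∷ []) ⟩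
  nontrivialProperDivisors k ++ filter P? (1 ∷ [])   ≡⟨ cong (nontrivialProperDivisors k ++_)
                                                           (filter-accept P? (1∣ (2 + k))) ⟩
  nontrivialProperDivisors k ∷ʳ 1                    ∎
  where
  open ≡-Reasoning
  P? : Decidable (_∣ 2 + k)
  P? = _∣? 2 + k

nontrivialProperDivisors-bounds : ∀ k → All (λ m → 1 < m × m ≤ suc k) (nontrivialProperDivisors k)
nontrivialProperDivisors-bounds k =
  filter⁺ _ (applyDownFrom⁺₁ (2 +_) k (λ i<k → s≤s (s≤s z≤n) , s≤s i<k))

aF-1 : ∀ g → aF g 1 ≡ 1
aF-1 zero    = refl
aF-1 (suc g) = refl

akF-diag : ∀ g n → akF g n n ≡ 1
akF-diag zero    n = refl
akF-diag (suc g) n rewrite dec-true (n ≟ n) refl = refl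

akF-suc-1 : ∀ g k → akF (suc g) (2 + k) 1 ≡ sum (map (λ m → akF g m 1) (properDivisors (2 + k)))
akF-suc-1 g k rewrite dec-true (1 ∣? 2 + k) (1∣ _) = refl

double-akF-1 : ∀ g m → 1 < m → m ≤ g → 2 * akF g m 1 ≡ aF g m
double-akF-1 (suc g) (suc zero)    (s≤s ()) _
double-akF-1 (suc g) (suc (suc k)) _ (s≤s k<g) = begin
  2 * akF (suc g) (2 + k) 1                  ≡⟨ cong (2 *_) (akF-suc-1 g k) ⟩
  2 * sum (map f (properDivisors (2 + k)))   ≡⟨ cong (λ ds → 2 * sum (map f ds)) (properDivisors-∷ʳ k) ⟩
  2 * sum (map f (ds ∷ʳ 1))                  ≡⟨ *-sum-map-∷ʳ 2 1 doubled-on-ds doubled-on-1 ⟩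
  1 + sum (map (aF g) (ds ∷ʳ 1))             ≡⟨ cong (λ ds → 1 + sum (map (aF g) ds)) (properDivisors-∷ʳ k) ⟨
  aF (suc g) (2 + k)                         ∎
  where
  open ≡-Reasoning
  f : ℕ → ℕ
  f m = akF g m 1

  ds : List ℕ
  ds = nontrivialProperDivisors k

  doubled-on-ds : All (λ m → 2 * f m ≡ aF g m) ds
  doubled-on-ds = All.map (λ (1<m , m≤1+k) → double-akF-1 g _ 1<m (≤-trans m≤1+k k<g))
                          (nontrivialProperDivisors-bounds k)

  doubled-on-1 : 2 * f 1 ≡ 1 + aF g 1
  doubled-on-1 rewrite akF-diag g 1 | aF-1 g = refl

lemma2 : (n : ℕ) → 1 < n → 2 * a₂ n 1 ≡ a n
lemma2 n 1<n = double-akF-1 n n 1<n ≤-refl
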